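{- Let $p$ be a prime, $\ell\ge1$, and $f\in P_{p^\ell}$ a periodic sequence. (1) If $f$ is idempotent, then $\mathrm{tr} f=0$. (2) If $\mathrm{tr} f=0$ and $p\nmid\tau(f)$, then $f$ is idempotent.
   Context: $P_{p^\ell}$ is the $\mathbb{Z}_{p^\ell}$-module of periodic sequences $f:\mathbb{N}\to\mathbb{Z}_{p^\ell}$, i.e. sequences with $f(n+j)=f(n)$ for all $n$ and some $j\ge1$. The period $\tau(f)$ is the least such $j$. The trace is $\mathrm{tr} f=\sum_{i=0}^{\tau(f)-1}f(i)$. With $\Delta f(n)=f(n+1)-f(n)$, $f$ is idempotent if $\Delta^\eta f=f$ for some $\eta\ge1$. -}

module Defs where

open import Data.Nat as ℕ using (ℕ; zero; suc; _≤_; _<_; _^_)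
open import Data.Integer as ℤ using (ℤ; +_; _-_)
open import Data.Integer.Divisibility using (_∣_)
open import Data.Product using (Σ; _×_; ∃-syntax)

-- Elements of ℤ_{m} are represented by integers up to congruence mod m.
infix 4 _≈[_]_ _≋[_]_
_≈[_]_ : ℤ → ℕ → ℤ → Set
a ≈[ m ] b = (+ m) ∣ (a - b)

-- Sequences ℕ → ℤ_m, represented as ℕ → ℤ (entries read modulo m).
Seq : Set
Seq = ℕ → ℤ

_≋[_]_ : Seq → ℕ → Seq → Set
f ≋[ m ] g = ∀ n → f n ≈[ m ] g n

IsPeriod : ℕ → Seq → ℕ → Set
IsPeriod m f j = (1 ≤ j) × (∀ n → f (n ℕ.+ j) ≈[ m ] f n)

Periodic : ℕ → Seq → Set
Periodic m f = ∃[ j ] IsPeriod m f j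

IsLeastPeriod : ℕ → Seq → ℕ → Set
IsLeastPeriod m f τ = IsPeriod m f τ × (∀ j → IsPeriod m f j → τ ≤ j)

sumTo : ℕ → Seq → ℤ
sumTo zero    f = + 0
sumTo (suc k) f = sumTo k f ℤ.+ f k

tr : ℕ → Seq → ℤ
tr τ f = sumTo τ f

Δ : Seq → Seq
Δ f n = f (suc n) - f n

Δ^ : ℕ → Seq → Seq
Δ^ zero    f = f
Δ^ (suc k) f = Δ (Δ^ k f)

Idempotent : ℕ → Seq → Set
Idempotent m f = ∃[ η ] ((1 ≤ η) × (Δ^ η f ≋[ m ] f))

-- Δ preserves τ-periodicity mod M, and the sum of Δ g over a period telescopes to
-- g τ − g 0 ≡ 0; applied to g = Δ^(η−1) f this gives (1).  For (2), there are only M^τ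
-- τ-periodic sequences mod M, so the orbit f, Δ f, Δ² f, … repeats: Δ^i f = Δ^(i+η) f.
-- Δ is injective on sequences of a fixed trace when τ is invertible mod M, since if
-- Δ g = Δ h then g − h is a constant c and tr g − tr h = τ c.  As f and every Δ^k f with
-- k ≥ 1 have trace zero, i applications of this cancellation give f = Δ^η f.
module Submission where

open import Defs
open import Data.Nat using (ℕ; _≤_; _^_)
open import Data.Nat.Primality using (Prime)
open import Data.Nat.Divisibility using (_∤_)
open import Data.Integer using (+_)
open import Data.Product using (_×_)

open import Data.Nat as ℕ using (zero; suc; _<_; NonZero)
open import Data.Nat.Properties as ℕ using (m<n⇒0<n∸m; m+[n∸m]≡n; <⇒≤)
open import Data.Nat.DivMod using (result; _divMod_)
open import Data.Nat.Divisibility as ℕ using (_∣_; divides)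
open import Data.Nat.Primality using (euclidsLemma; prime⇒nonZero)
open import Data.Integer using (ℤ; _+_; _-_; -_; _*_; ∣_∣)
open import Data.Integer.Properties using (+-identityʳ; +-inverseʳ; abs-*)
open import Data.Integer.DivMod using (_%ℕ_; _/ℕ_; n%ℕd<d; a≡a%ℕn+[a/ℕn]*n)
open import Data.Integer.Divisibility.Signed as Signed using (∣⇒∣ᵤ; ∣ᵤ⇒∣)
open import Data.Integer.Tactic.RingSolver using (solve-∀)
open import Data.Fin using (Fin; toℕ; fromℕ<; funToFin; finToFun)
open import Data.Fin.Properties using (toℕ-fromℕ<; pigeonhole; finToFun-funToFin)
open import Data.Product using (_,_; ∃-syntax)
open import Data.Sum using (inj₁; inj₂)
open import Relation.Nullary using (contradiction)
open import Relation.Binary.PropositionalEquality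

prime^∣*-cancelˡ : ∀ {p m} → Prime p → p ∤ m → ∀ ℓ n → p ^ ℓ ∣ m ℕ.* n → p ^ ℓ ∣ n
prime^∣*-cancelˡ pp p∤m zero    n _ = ℕ.1∣ n
prime^∣*-cancelˡ {p} {m} pp p∤m (suc ℓ) n p^1+ℓ∣mn
  with euclidsLemma m n pp (ℕ.∣-trans (ℕ.m∣m*n (p ^ ℓ)) p^1+ℓ∣mn)
... | inj₁ p∣m = contradiction p∣m p∤m
... | inj₂ (divides q refl) =
  ℕ.∣-trans (ℕ.*-monoʳ-∣ p p^ℓ∣q) (ℕ.∣-reflexive (ℕ.*-comm p q))
  where
  instance _ = prime⇒nonZero pp
  m[qp]≡p[mq] : m ℕ.* (q ℕ.* p) ≡ p ℕ.* (m ℕ.* q)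
  m[qp]≡p[mq] = trans (sym (ℕ.*-assoc m q p)) (ℕ.*-comm (m ℕ.* q) p)
  p^ℓ∣q : p ^ ℓ ∣ q
  p^ℓ∣q = prime^∣*-cancelˡ pp p∤m ℓ q
    (ℕ.*-cancelˡ-∣ p (subst (p ^ suc ℓ ∣_) m[qp]≡p[mq] p^1+ℓ∣mn))

sumTo-Δ : ∀ g k → sumTo k (Δ g) ≡ g k - g 0
sumTo-Δ g zero    = sym (+-inverseʳ (g 0))
sumTo-Δ g (suc k) = trans (cong (_+ Δ g k) (sumTo-Δ g k)) (telescope (g k) (g 0) (g (suc k)))
  where
  telescope : ∀ a b c → (a - b) + (c - a) ≡ c - b
  telescope = solve-∀

sumTo-diff : ∀ g h k → sumTo k (λ n → g n - h n) ≡ sumTo k g - sumTo k h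
sumTo-diff g h zero    = refl
sumTo-diff g h (suc k) =
  trans (cong (_+ (g k - h k)) (sumTo-diff g h k)) (interchange (sumTo k g) (sumTo k h) (g k) (h k))
  where
  interchange : ∀ a b c d → (a - b) + (c - d) ≡ (a + c) - (b + d)
  interchange = solve-∀

Δ^-suc : ∀ k g → Δ^ (suc k) g ≡ Δ^ k (Δ g)
Δ^-suc zero    g = refl
Δ^-suc (suc k) g = cong Δ (Δ^-suc k g)

Δ^-+ : ∀ i j g → Δ^ (i ℕ.+ j) g ≡ Δ^ i (Δ^ j g)
Δ^-+ zero    j g = refl
Δ^-+ (suc i) j g = cong Δ (Δ^-+ i j g)

module Modulo (M : ℕ) where

  -- Unlike a ≈[ M ] b, the record type lets Agda infer a and b.
  infix 4 _≈_ _≋_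
  record _≈_ (a b : ℤ) : Set where
    constructor mk≈
    field ≈[M] : a ≈[ M ] b
  open _≈_ public

  _≋_ : Seq → Seq → Set
  g ≋ h = ∀ n → g n ≈ h n

  ≈-via : ∀ {a b c} → a - b ≡ c → + M Signed.∣ c → a ≈ b
  ≈-via refl M∣c = mk≈ (∣⇒∣ᵤ M∣c)

  ≈⇒∣ : ∀ {a b} → a ≈ b → + M Signed.∣ (a - b)
  ≈⇒∣ a≈b = ∣ᵤ⇒∣ (≈[M] a≈b)

  ≈-refl : ∀ {a} → a ≈ a
  ≈-refl {a} = ≈-via (+-inverseʳ a) (Signed.divides (+ 0) refl)

  ≈-sym : ∀ {a b} → a ≈ b → b ≈ a
  ≈-sym {a} {b} a≈b = ≈-via (neg a b) (Signed.∣m⇒∣-m (≈⇒∣ a≈b))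
    where
    neg : ∀ a b → b - a ≡ - (a - b)
    neg = solve-∀

  ≈-trans : ∀ {a b c} → a ≈ b → b ≈ c → a ≈ c
  ≈-trans {a} {b} {c} a≈b b≈c = ≈-via (split a b c) (Signed.∣m∣n⇒∣m+n (≈⇒∣ a≈b) (≈⇒∣ b≈c))
    where
    split : ∀ a b c → a - c ≡ (a - b) + (b - c)
    split = solve-∀

  +-cong : ∀ {a b c d} → a ≈ b → c ≈ d → a + c ≈ b + d
  +-cong {a} {b} {c} {d} a≈b c≈d =
    ≈-via (interchange a b c d) (Signed.∣m∣n⇒∣m+n (≈⇒∣ a≈b) (≈⇒∣ c≈d))
    where
    interchange : ∀ a b c d → (a + c) - (b + d) ≡ (a - b) + (c - d)
    interchange = solve-∀

  -cong : ∀ {a b c d} → a ≈ b → c ≈ d → a - c ≈ b - d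
  -cong {a} {b} {c} {d} a≈b c≈d =
    ≈-via (interchange a b c d) (Signed.∣m∣n⇒∣m-n (≈⇒∣ a≈b) (≈⇒∣ c≈d))
    where
    interchange : ∀ a b c d → (a - c) - (b - d) ≡ (a - b) - (c - d)
    interchange = solve-∀

  -≈0⇒≈ : ∀ {a b} → a - b ≈ + 0 → a ≈ b
  -≈0⇒≈ {a} {b} a-b≈0 = ≈-via (sym (+-identityʳ (a - b))) (≈⇒∣ a-b≈0)

  ≈⇒-≈0 : ∀ {a b} → a ≈ b → a - b ≈ + 0
  ≈⇒-≈0 {a} {b} a≈b = ≈-via (+-identityʳ (a - b)) (≈⇒∣ a≈b)

  ≈0⇒∣ : ∀ {a} → a ≈ + 0 → M ∣ ∣ a ∣
  ≈0⇒∣ {a} a≈0 = subst (λ x → M ∣ ∣ x ∣) (+-identityʳ a) (≈[M] a≈0)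

  ∣⇒≈0 : ∀ {a} → M ∣ ∣ a ∣ → a ≈ + 0
  ∣⇒≈0 {a} M∣a = mk≈ (subst (λ x → M ∣ ∣ x ∣) (sym (+-identityʳ a)) M∣a)

  sumTo-cong : ∀ {g h} → g ≋ h → ∀ k → sumTo k g ≈ sumTo k h
  sumTo-cong g≋h zero    = ≈-refl
  sumTo-cong g≋h (suc k) = +-cong (sumTo-cong g≋h k) (g≋h k)

  sumTo-const : ∀ {g c} → (∀ n → g n ≈ c) → ∀ k → sumTo k g ≈ + k * c
  sumTo-const g≈c zero = ≈-refl
  sumTo-const {g} {c} g≈c (suc k) =
    subst (sumTo (suc k) g ≈_) (sym (suc-* (+ k) c)) (+-cong (sumTo-const g≈c k) (g≈c k))
    where
    suc-* : ∀ k c → (+ 1 + k) * c ≡ k * c + c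
    suc-* = solve-∀

  HasPeriod : ℕ → Seq → Set
  HasPeriod τ g = ∀ n → g (n ℕ.+ τ) ≈ g n

  module _ {τ : ℕ} where

    Δ-hasPeriod : ∀ {g} → HasPeriod τ g → HasPeriod τ (Δ g)
    Δ-hasPeriod per n = -cong (per (suc n)) (per n)

    Δ^-hasPeriod : ∀ k {g} → HasPeriod τ g → HasPeriod τ (Δ^ k g)
    Δ^-hasPeriod zero    per = per
    Δ^-hasPeriod (suc k) per = Δ-hasPeriod (Δ^-hasPeriod k per)

    sumTo-Δ≈0 : ∀ {g} → HasPeriod τ g → sumTo τ (Δ g) ≈ + 0
    sumTo-Δ≈0 {g} per = subst (_≈ + 0) (sym (sumTo-Δ g τ)) (≈⇒-≈0 (per 0))

    sumTo-Δ^≈0 : ∀ {k g} → 1 ≤ k → HasPeriod τ g → sumTo τ (Δ^ k g) ≈ + 0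
    sumTo-Δ^≈0 {suc k} _ per = sumTo-Δ≈0 (Δ^-hasPeriod k per)

    hasPeriod-+* : ∀ {g} → HasPeriod τ g → ∀ r q → g (r ℕ.+ q ℕ.* τ) ≈ g r
    hasPeriod-+* {g} per r zero    = subst (λ n → g n ≈ g r) (sym (ℕ.+-identityʳ r)) ≈-refl
    hasPeriod-+* {g} per r (suc q) =
      subst (λ n → g n ≈ g r) (reassoc r (q ℕ.* τ)) (≈-trans (per _) (hasPeriod-+* per r q))
      where
      reassoc : ∀ r s → r ℕ.+ s ℕ.+ τ ≡ r ℕ.+ (τ ℕ.+ s)
      reassoc r s = trans (ℕ.+-assoc r s τ) (cong (r ℕ.+_) (ℕ.+-comm s τ))

    hasPeriod-≋ : .{{NonZero τ}} → ∀ {g h} → HasPeriod τ g → HasPeriod τ h →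
                  (∀ (t : Fin τ) → g (toℕ t) ≈ h (toℕ t)) → g ≋ h
    hasPeriod-≋ pg ph g≈h n with n divMod τ
    ... | result q t refl =
      ≈-trans (hasPeriod-+* pg (toℕ t) q) (≈-trans (g≈h t) (≈-sym (hasPeriod-+* ph (toℕ t) q)))

  idempotent⇒sumTo≈0 : ∀ {τ f} → HasPeriod τ f → Idempotent M f → sumTo τ f ≈ + 0
  idempotent⇒sumTo≈0 {τ} per (η , η≥1 , Δ^ηf≈f) =
    ≈-trans (sumTo-cong (λ n → ≈-sym (mk≈ (Δ^ηf≈f n))) τ) (sumTo-Δ^≈0 η≥1 per)

  Cancellable : ℕ → Set
  Cancellable τ = ∀ x → + τ * x ≈ + 0 → x ≈ + 0

  module _ {τ : ℕ} (cancel-τ : Cancellable τ) where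

    Δ-cancel : ∀ {g h} → Δ g ≋ Δ h → sumTo τ g ≈ sumTo τ h → g ≋ h
    Δ-cancel {g} {h} Δg≋Δh Σg≈Σh n = -≈0⇒≈ (≈-trans (e-const n) e0≈0)
      where
      e : Seq
      e n = g n - h n
      interchange : ∀ a b c d → (a - c) - (b - d) ≡ (a - b) - (c - d)
      interchange = solve-∀
      e-step : ∀ n → e (suc n) ≈ e n
      e-step n = -≈0⇒≈ (subst (_≈ + 0) (interchange (g (suc n)) (h (suc n)) (g n) (h n))
                                        (≈⇒-≈0 (Δg≋Δh n)))
      e-const : ∀ n → e n ≈ e 0
      e-const zero    = ≈-refl
      e-const (suc n) = ≈-trans (e-step n) (e-const n)
      Σe≈0 : sumTo τ e ≈ + 0
      Σe≈0 = subst (_≈ + 0) (sym (sumTo-diff g h τ)) (≈⇒-≈0 Σg≈Σh)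
      e0≈0 : e 0 ≈ + 0
      e0≈0 = cancel-τ (e 0) (≈-trans (≈-sym (sumTo-const e-const τ)) Σe≈0)

    Δ^-cancel : ∀ i {g h} → HasPeriod τ g → HasPeriod τ h → sumTo τ g ≈ sumTo τ h →
                Δ^ i g ≋ Δ^ i h → g ≋ h
    Δ^-cancel zero    pg ph Σg≈Σh Δ^g≋Δ^h = Δ^g≋Δ^h
    Δ^-cancel (suc i) {g} {h} pg ph Σg≈Σh Δ^g≋Δ^h = Δ-cancel Δg≋Δh Σg≈Σh
      where
      Δg≋Δh : Δ g ≋ Δ h
      Δg≋Δh = Δ^-cancel i (Δ-hasPeriod pg) (Δ-hasPeriod ph)
        (≈-trans (sumTo-Δ≈0 pg) (≈-sym (sumTo-Δ≈0 ph)))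
        (subst₂ (λ u v → u ≋ v) (Δ^-suc i g) (Δ^-suc i h) Δ^g≋Δ^h)

  module _ .{{_ : NonZero M}} where

    residue : ℤ → Fin M
    residue a = fromℕ< (n%ℕd<d a M)

    residue-injective : ∀ a b → residue a ≡ residue b → a ≈ b
    residue-injective a b ra≡rb = ≈-via a-b≡[qa-qb]M (Signed.divides (a /ℕ M - b /ℕ M) refl)
      where
      a%M≡b%M : a %ℕ M ≡ b %ℕ M
      a%M≡b%M = trans (sym (toℕ-fromℕ< _)) (trans (cong toℕ ra≡rb) (toℕ-fromℕ< _))
      same-remainder : ∀ r qa qb m → (r + qa * m) - (r + qb * m) ≡ (qa - qb) * m
      same-remainder = solve-∀
      a-b≡[qa-qb]M : a - b ≡ (a /ℕ M - b /ℕ M) * + M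
      a-b≡[qa-qb]M = begin
        a - b
          ≡⟨ cong₂ _-_ (a≡a%ℕn+[a/ℕn]*n a M) (a≡a%ℕn+[a/ℕn]*n b M) ⟩
        (+ (a %ℕ M) + a /ℕ M * + M) - (+ (b %ℕ M) + b /ℕ M * + M)
          ≡⟨ cong (λ r → (+ (a %ℕ M) + a /ℕ M * + M) - (+ r + b /ℕ M * + M)) (sym a%M≡b%M) ⟩
        (+ (a %ℕ M) + a /ℕ M * + M) - (+ (a %ℕ M) + b /ℕ M * + M)
          ≡⟨ same-remainder (+ (a %ℕ M)) (a /ℕ M) (b /ℕ M) (+ M) ⟩
        (a /ℕ M - b /ℕ M) * + M ∎
        where open ≡-Reasoning

    -- A τ-periodic sequence mod M is determined by its residues at 0, …, τ−1, an element of
    -- Fin (M ^ τ); the pigeonhole principle among M ^ τ + 1 iterates of Δ gives the repeat.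
    Δ^-repeats : ∀ {τ} .{{_ : NonZero τ}} {f} → HasPeriod τ f →
                 ∃[ i ] ∃[ j ] i < j × Δ^ i f ≋ Δ^ j f
    Δ^-repeats {τ} {f} per with pigeonhole (ℕ.n<1+n (M ^ τ)) code
      where
      code : Fin (suc (M ^ τ)) → Fin (M ^ τ)
      code k = funToFin {τ} {M} (λ t → residue (Δ^ (toℕ k) f (toℕ t)))
    ... | a , b , a<b , code-a≡code-b =
      toℕ a , toℕ b , a<b ,
      hasPeriod-≋ (Δ^-hasPeriod (toℕ a) per) (Δ^-hasPeriod (toℕ b) per) agree
      where
      agree : ∀ t → Δ^ (toℕ a) f (toℕ t) ≈ Δ^ (toℕ b) f (toℕ t)
      agree t = residue-injective _ _ (trans (sym (finToFun-funToFin _ t))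
                  (trans (cong (λ c → finToFun c t) code-a≡code-b) (finToFun-funToFin _ t)))

    sumTo≈0⇒idempotent : ∀ {τ} .{{_ : NonZero τ}} → Cancellable τ → ∀ {f} →
                         HasPeriod τ f → sumTo τ f ≈ + 0 → Idempotent M f
    sumTo≈0⇒idempotent cancel-τ {f} per Σf≈0 with Δ^-repeats per
    ... | i , j , i<j , Δ^if≋Δ^jf = η , η≥1 , λ n → ≈[M] (≈-sym (f≋Δ^ηf n))
      where
      η = j ℕ.∸ i
      η≥1 : 1 ≤ η
      η≥1 = m<n⇒0<n∸m i<j
      Δ^jf≡Δ^iΔ^ηf : Δ^ j f ≡ Δ^ i (Δ^ η f)
      Δ^jf≡Δ^iΔ^ηf = trans (cong (λ k → Δ^ k f) (sym (m+[n∸m]≡n (<⇒≤ i<j)))) (Δ^-+ i η f)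
      f≋Δ^ηf : f ≋ Δ^ η f
      f≋Δ^ηf = Δ^-cancel cancel-τ i per (Δ^-hasPeriod η per)
        (≈-trans Σf≈0 (≈-sym (sumTo-Δ^≈0 η≥1 per)))
        (subst (Δ^ i f ≋_) Δ^jf≡Δ^iΔ^ηf Δ^if≋Δ^jf)

corollary2p7 : (p ℓ : ℕ) → Prime p → 1 ≤ ℓ → (f : Seq) → (τ : ℕ) → IsLeastPeriod (p ^ ℓ) f τ →
    (Idempotent (p ^ ℓ) f → tr τ f ≈[ p ^ ℓ ] + 0)
    × (tr τ f ≈[ p ^ ℓ ] + 0 → p ∤ τ → Idempotent (p ^ ℓ) f)
corollary2p7 p ℓ pp _ f τ ((τ≥1 , τ-period) , _) =
  (λ idem → ≈[M] (idempotent⇒sumTo≈0 per idem)) ,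
  (λ tr≈0 p∤τ → sumTo≈0⇒idempotent (cancellable p∤τ) per (mk≈ tr≈0))
  where
  open Modulo (p ^ ℓ)
  instance
    _ = prime⇒nonZero pp
    _ = ℕ.m^n≢0 p ℓ
    _ = ℕ.>-nonZero τ≥1
  per : HasPeriod τ f
  per n = mk≈ (τ-period n)
  cancellable : p ∤ τ → Cancellable τ
  cancellable p∤τ x τx≈0 =
    ∣⇒≈0 (prime^∣*-cancelˡ pp p∤τ ℓ ∣ x ∣ (subst (p ^ ℓ ∣_) (abs-* (+ τ) x) (≈0⇒∣ τx≈0)))
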